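{- Let $G=(V,E)$ be a cocomparability graph with $|V|=n$ and let $\sigma=(u_1,u_2,\dots,u_n,u_{n+1})$ be an LDFS umbrella-free ordering of $V\cup\{u_{n+1}\}$, where $u_{n+1}$ is a dummy isolated vertex. Let $i,j\in\{1,\dots,n\}$, and let $P$ be a longest normal path of $G(i,j)$ with $u_y\neq u_i$ as its last vertex, where $P=(P_1,u_i,P_2)$ (i.e. $P$ contains $u_i$, $P_1$ is the subpath before $u_i$ and $P_2$ the subpath after $u_i$). Let $u_x$ be the last vertex of $P_1$. Then $P_1$ is a longest normal path of $G(i+1,j)$ with $u_x$ as its last vertex, and $P_2$ is a longest normal path of $G(i+1,x-1)$ with $u_y$ as its last vertex.
   Context: Graphs are finite, simple, undirected; $N(v)$ is the neighborhood of $v$ in $G$. A path $(v_1,\dots,v_k)$ is a sequence of distinct vertices with $v_iv_{i+1}\in E$; its length is its number of vertices. An ordering $\sigma$ is umbrella-free if for all $x<_\sigma y<_\sigma z$, $xz\in E$ implies $xy\in E$ or $yz\in E$. For an ordering $\sigma$, a triple $(a,b,c)$ with $a<_\sigma b<_\sigma c$, $ac\in E$, $ab\notin E$ is good if there is a vertex $d$ with $a<_\sigma d<_\sigma b$, $db\in E$, $dc\notin E$, and bad otherwise; $\sigma$ is an LDFS ordering if it has no bad triple. Vertices are indexed by position in $\sigma$; $u_{n+1}$ is adjacent to no vertex. For indices $i,j$: if $i>j$, $G(i,j)$ is empty; if $i\le j$, $G(i,j)$ is the subgraph of $G$ induced by $\{u_i,\dots,u_j\}\setminus N(u_{j+1})$.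 A path $P=(v_1,\dots,v_k)$ of a subgraph $H$ is normal (w.r.t. $\sigma$) if $v_1$ is the rightmost vertex of $V(P)$ in $\sigma$ and, for every $i=2,\dots,k$, $v_i$ is the rightmost vertex of $N(v_{i-1})\cap\{v_i,\dots,v_k\}$ in $\sigma$. "$P$ is a longest normal path of $H$ with $u_k$ as its last vertex" means $P$ has the maximum number of vertices among all normal paths of $H$ whose last vertex is $u_k$. -}

module Defs where

open import Data.Nat using (ℕ; suc; _≤_; _<_; _∸_)
open import Data.Bool using (Bool; true)
open import Data.List using (List; []; _∷_; length; last)
open import Data.List.Membership.Propositional using (_∈_)
open import Data.List.Relation.Unary.All using (All)
open import Data.List.Relation.Unary.Unique.Propositional using (Unique)
open import Data.Maybe using (just)
open import Data.Product using (Σ; ∃; _×_)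
open import Data.Sum using (_⊎_)
open import Data.Unit using (⊤)
open import Relation.Binary.PropositionalEquality using (_≡_)
open import Relation.Nullary using (¬_)

-- A finite simple graph whose vertices are identified with their positions
-- 1..n in the ordering σ; index n+1 is the dummy isolated vertex u_{n+1}
-- (automatically isolated, since edges only join indices in 1..n).
-- The ordering σ is the natural order of indices.
record Graph : Set where
  field
    n     : ℕ
    adj   : ℕ → ℕ → Bool
    sym   : ∀ a b → adj a b ≡ true → adj b a ≡ true
    irrefl : ∀ a → ¬ (adj a a ≡ true)
    inV   : ∀ a b → adj a b ≡ true → (1 ≤ a × a ≤ n)

module _ (G : Graph) where
  open Graph G

  E : ℕ → ℕ → Set
  E a b = adj a b ≡ true

  Vertex : ℕ → Set
  Vertex a = 1 ≤ a × a ≤ n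

  Cocomparability : Set₁
  Cocomparability =
    Σ (ℕ → ℕ → Set) λ O →
      (∀ a b → Vertex a → Vertex b → ¬ a ≡ b → ¬ E a b → O a b ⊎ O b a)
      × (∀ a b → O a b → Vertex a × Vertex b × ¬ a ≡ b × ¬ E a b)
      × (∀ a b → O a b → ¬ O b a)
      × (∀ a b c → O a b → O b c → O a c)

  UmbrellaFree : Set
  UmbrellaFree = ∀ x y z → x < y → y < z → E x z → E x y ⊎ E y z

  LDFS : Set
  LDFS = ∀ a b c → a < b → b < c → E a c → ¬ E a b →
         ∃ λ d → a < d × d < b × E d b × ¬ E d c

  -- vertex set of G(i,j): {u_i,…,u_j} \ N(u_{j+1}) (empty when i > j)
  InG : ℕ → ℕ → ℕ → Set
  InG i j k = i ≤ k × k ≤ j × ¬ E k (suc j)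

  Walk : List ℕ → Set
  Walk []           = ⊤
  Walk (a ∷ [])     = ⊤
  Walk (a ∷ b ∷ xs) = E a b × Walk (b ∷ xs)

  IsPath : (ℕ → Set) → List ℕ → Set
  IsPath S P = ¬ P ≡ [] × All S P × Unique P × Walk P

  NormalTail : List ℕ → Set
  NormalTail []           = ⊤
  NormalTail (a ∷ [])     = ⊤
  NormalTail (a ∷ b ∷ xs) =
    (∀ w → w ∈ (b ∷ xs) → E a w → w ≤ b) × NormalTail (b ∷ xs)

  FirstRightmost : List ℕ → Set
  FirstRightmost []      = ⊤
  FirstRightmost (a ∷ xs) = All (λ w → w ≤ a) xs

  NormalPath : (ℕ → Set) → List ℕ → Set
  NormalPath S P = IsPath S P × FirstRightmost P × NormalTail P

  LongestNormalEndingAt : (ℕ → Set) → ℕ → List ℕ → Set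
  LongestNormalEndingAt S k P =
    NormalPath S P × last P ≡ just k ×
    (∀ Q → NormalPath S Q → last Q ≡ just k → length Q ≤ length P)

module Submission where

-- The key fact is that in a normal path every vertex is adjacent to each
-- later vertex z lying to its right in σ.  Along the path every vertex lies
-- right of z or is adjacent to it: a vertex b left of z that follows a vertex
-- h right of z is adjacent to z, since (b, z, h) is no umbrella and h z ∉ E by
-- normality at h; and the successor of a neighbour of z lies right of z by
-- normality.
--
-- From P = (P₁, u_i, P₂): every vertex z of P₂ lies right of u_i, is not
-- adjacent to u_x (normality at u_x) and lies left of u_x (a forward edge from
-- u_x would contradict the same), so P₂ lives in G(i+1, x-1); its first vertex
-- is rightmost because u_i is adjacent to all of P₂.  Conversely any normal
-- path Q of G(i+1, j) ending at u_x and any normal path R of G(i+1, x-1) can be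
-- spliced into the normal path (Q, u_i, R) of G(i, j), so neither part of P can
-- be lengthened.

open import Defs
open import Function using (id)
open import Data.Nat using (ℕ; zero; suc; _≤_; _<_; _∸_; s≤s)
open import Data.Nat.Properties
  using (≤-refl; ≤-trans; <⇒≤; <⇒≱; <⇒≯; ≤∧≢⇒<; <-irrefl; <-cmp; ≤-pred; n≤1+n; +-cancelˡ-≤; +-cancelʳ-≤)
open import Data.List using (List; []; _∷_; _++_; _∷ʳ_; last; length; initLast; _∷ʳ′_)
open import Data.List.Properties using (++-assoc; ∷ʳ-++; length-++; ++-conicalʳ)
open import Data.List.Membership.Propositional using (_∈_)
open import Data.List.Membership.Propositional.Properties using (∈-++⁺ˡ; ∈-++⁺ʳ; ∈-++⁻; ∈-∃++)
open import Data.List.Relation.Unary.Any using (here; there)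
open import Data.List.Relation.Unary.All as All using (All; []; _∷_)
open import Data.List.Relation.Unary.All.Properties using (++⁺; ++⁻ˡ; ++⁻ʳ)
open import Data.List.Relation.Unary.AllPairs as AllPairs using ([]; _∷_)
open import Data.List.Relation.Unary.Unique.Propositional using (Unique)
import Data.List.Relation.Unary.Unique.Propositional.Properties as Unique
open import Data.List.Relation.Binary.Disjoint.Propositional using (Disjoint)
open import Data.Maybe using (just)
open import Data.Maybe.Properties using (just-injective)
open import Data.Product using (_×_; _,_; proj₁; proj₂)
open import Data.Sum using (_⊎_; inj₁; inj₂; [_,_])
import Data.Sum as Sum
open import Data.Unit using (tt)
open import Relation.Binary.Definitions using (tri<; tri≈; tri>)
open import Relation.Binary.PropositionalEquality using (_≡_; _≢_; refl; sym; trans; subst; subst₂)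
open import Relation.Nullary using (¬_; contradiction)

last-++ : ∀ {A : Set} (xs : List A) {a ys} → last (xs ++ a ∷ ys) ≡ last (a ∷ ys)
last-++ []           = refl
last-++ (b ∷ [])     = refl
last-++ (b ∷ c ∷ xs) = last-++ (c ∷ xs)

++-∷-nonempty : ∀ {A : Set} (xs : List A) {a ys} → xs ++ a ∷ ys ≢ []
++-∷-nonempty xs e = contradiction (++-conicalʳ xs _ e) λ ()

Unique-++⁻ : ∀ {A : Set} (xs : List A) {ys} → Unique (xs ++ ys) → Unique xs × Unique ys × Disjoint xs ys
Unique-++⁻ []       unique        = [] , unique , λ { (() , _) }
Unique-++⁻ (x ∷ xs) (x∉ ∷ unique) with Unique-++⁻ xs unique
... | uniqueˡ , uniqueʳ , disjoint = ++⁻ˡ xs x∉ ∷ uniqueˡ , uniqueʳ , disjoint′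
  where
  disjoint′ : Disjoint (x ∷ xs) _
  disjoint′ (here refl , v∈) = All.lookup (++⁻ʳ xs x∉) v∈ refl
  disjoint′ (there v∈ , v∈′) = disjoint (v∈ , v∈′)

length-++-cancelʳ-≤ : ∀ {A : Set} (xs ys zs : List A) →
                      length (xs ++ zs) ≤ length (ys ++ zs) → length xs ≤ length ys
length-++-cancelʳ-≤ xs ys zs le =
  +-cancelʳ-≤ (length zs) _ _ (subst₂ _≤_ (length-++ xs) (length-++ ys) le)

length-++-cancelˡ-≤ : ∀ {A : Set} (xs ys zs : List A) →
                      length (xs ++ ys) ≤ length (xs ++ zs) → length ys ≤ length zs
length-++-cancelˡ-≤ xs ys zs le =
  +-cancelˡ-≤ (length xs) _ _ (subst₂ _≤_ (length-++ xs) (length-++ xs) le)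

module _ (G : Graph) where

  E-sym : ∀ {a b} → E G a b → E G b a
  E-sym = Graph.sym G _ _

  InG-lower : ∀ {i i′ j v} → i ≤ i′ → InG G i′ j v → InG G i j v
  InG-lower i≤i′ (i′≤v , v≤j , v≁j) = ≤-trans i≤i′ i′≤v , v≤j , v≁j

  Walk-∷⁻ : ∀ {a} xs → Walk G (a ∷ xs) → Walk G xs
  Walk-∷⁻ []      _          = tt
  Walk-∷⁻ (_ ∷ _) (_ , walk) = walk

  Walk-++⁻ˡ : ∀ xs {ys} → Walk G (xs ++ ys) → Walk G xs
  Walk-++⁻ˡ []           _           = tt
  Walk-++⁻ˡ (a ∷ [])     _           = tt
  Walk-++⁻ˡ (a ∷ b ∷ xs) (ab , walk) = ab , Walk-++⁻ˡ (b ∷ xs) walk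

  Walk-++⁻ʳ : ∀ xs {ys} → Walk G (xs ++ ys) → Walk G ys
  Walk-++⁻ʳ []       walk = walk
  Walk-++⁻ʳ (_ ∷ xs) walk = Walk-++⁻ʳ xs (Walk-∷⁻ (xs ++ _) walk)

  Walk-∷ʳ-++⁺ : ∀ xs {a ys} → Walk G (xs ∷ʳ a) → Walk G (a ∷ ys) → Walk G (xs ∷ʳ a ++ ys)
  Walk-∷ʳ-++⁺ []           _            walk = walk
  Walk-∷ʳ-++⁺ (b ∷ [])     (ba , _)     walk = ba , walk
  Walk-∷ʳ-++⁺ (b ∷ c ∷ xs) (bc , walk₁) walk = bc , Walk-∷ʳ-++⁺ (c ∷ xs) walk₁ walk

  NormalTail-∷⁻ : ∀ {a} xs → NormalTail G (a ∷ xs) → NormalTail G xs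
  NormalTail-∷⁻ []      _          = tt
  NormalTail-∷⁻ (_ ∷ _) (_ , tail) = tail

  NormalTail-++⁻ˡ : ∀ xs {ys} → NormalTail G (xs ++ ys) → NormalTail G xs
  NormalTail-++⁻ˡ []           _                  = tt
  NormalTail-++⁻ˡ (a ∷ [])     _                  = tt
  NormalTail-++⁻ˡ (a ∷ b ∷ xs) (rightmost , tail) =
    (λ w w∈ → rightmost w (∈-++⁺ˡ w∈)) , NormalTail-++⁻ˡ (b ∷ xs) tail

  NormalTail-++⁻ʳ : ∀ xs {ys} → NormalTail G (xs ++ ys) → NormalTail G ys
  NormalTail-++⁻ʳ []       tail = tail
  NormalTail-++⁻ʳ (_ ∷ xs) tail = NormalTail-++⁻ʳ xs (NormalTail-∷⁻ (xs ++ _) tail)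

  NormalTail-∷ʳ-++⁺ : ∀ xs {a ys} → NormalTail G (xs ∷ʳ a) → NormalTail G (a ∷ ys) → All (_≤ a) ys →
                      (∀ {b w} → b ∈ xs → w ∈ ys → E G b w → E G b a ⊎ All (w ≤_) xs) →
                      NormalTail G (xs ∷ʳ a ++ ys)
  NormalTail-∷ʳ-++⁺ [] _ tail _ _ = tail
  NormalTail-∷ʳ-++⁺ (b ∷ []) {a} {ys} _ tail ys≤a _ = rightmost , tail
    where
    rightmost : ∀ w → w ∈ a ∷ ys → E G b w → w ≤ a
    rightmost _ (here refl) _ = ≤-refl
    rightmost _ (there w∈) _  = All.lookup ys≤a w∈
  NormalTail-∷ʳ-++⁺ (b ∷ c ∷ xs) {a} {ys} (rightmost₁ , tail₁) tail ys≤a cross =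
    rightmost , NormalTail-∷ʳ-++⁺ (c ∷ xs) tail₁ tail ys≤a
                  (λ b∈ w∈ bw → Sum.map₂ All.tail (cross (there b∈) w∈ bw))
    where
    rightmost : ∀ w → w ∈ c ∷ xs ∷ʳ a ++ ys → E G b w → w ≤ c
    rightmost w w∈ bw with ∈-++⁻ (c ∷ xs ∷ʳ a) w∈
    ... | inj₁ w∈₁ = rightmost₁ w w∈₁ bw
    ... | inj₂ w∈ys with cross (here refl) w∈ys bw
    ...   | inj₁ ba   = ≤-trans (All.lookup ys≤a w∈ys) (rightmost₁ a (∈-++⁺ʳ (c ∷ xs) (here refl)) ba)
    ...   | inj₂ w≤xs = All.lookup w≤xs (there (here refl))

  FirstRightmost-head : ∀ {h xs w} → FirstRightmost G (h ∷ xs) → w ∈ h ∷ xs → w ≤ h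
  FirstRightmost-head _         (here refl) = ≤-refl
  FirstRightmost-head rightmost (there w∈)  = All.lookup rightmost w∈

  FirstRightmost-++⁻ˡ : ∀ xs {ys} → FirstRightmost G (xs ++ ys) → FirstRightmost G xs
  FirstRightmost-++⁻ˡ []       _         = tt
  FirstRightmost-++⁻ˡ (_ ∷ xs) rightmost = ++⁻ˡ xs rightmost

  FirstRightmost-∷ʳ-++⁺ : ∀ xs {a ys} → FirstRightmost G (xs ∷ʳ a) → All (_≤ a) ys →
                          FirstRightmost G (xs ∷ʳ a ++ ys)
  FirstRightmost-∷ʳ-++⁺ []       _         ys≤a = ys≤a
  FirstRightmost-∷ʳ-++⁺ (h ∷ xs) rightmost ys≤a =
    ++⁺ rightmost (All.map (λ w≤a → ≤-trans w≤a (All.lookup rightmost (∈-++⁺ʳ xs (here refl)))) ys≤a)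

  NormalPath-inside : ∀ {S T L} → All T L → NormalPath G S L → NormalPath G T L
  NormalPath-inside inT ((nonempty , _ , unique , walk) , rightmost , tail) =
    (nonempty , inT , unique , walk) , rightmost , tail

  NormalPath-++⁻ˡ : ∀ {S} xs {ys} → xs ≢ [] → NormalPath G S (xs ++ ys) → NormalPath G S xs
  NormalPath-++⁻ˡ xs nonempty ((_ , inS , unique , walk) , rightmost , tail) =
    (nonempty , ++⁻ˡ xs inS , proj₁ (Unique-++⁻ xs unique) , Walk-++⁻ˡ xs walk) ,
    FirstRightmost-++⁻ˡ xs rightmost , NormalTail-++⁻ˡ xs tail

  NormalPath-∷ʳ-++⁻ : ∀ {S} xs {a ys} → NormalPath G S (xs ∷ʳ a ++ ys) →
                      Walk G (a ∷ ys) × NormalTail G (a ∷ ys)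
  NormalPath-∷ʳ-++⁻ xs {a} {ys} ((_ , _ , _ , walk) , _ , tail) =
    Walk-++⁻ʳ xs (subst (Walk G) (∷ʳ-++ xs a ys) walk) ,
    NormalTail-++⁻ʳ xs (subst (NormalTail G) (∷ʳ-++ xs a ys) tail)

  prefix-normal : ∀ {i j} P₁ P₂ → P₁ ≢ [] → NormalPath G (InG G i j) (P₁ ++ i ∷ P₂) →
                  NormalPath G (InG G (suc i) j) P₁
  prefix-normal {i} P₁ P₂ nonempty path@((_ , inP , unique , _) , _) =
    NormalPath-inside (All.tabulate right-of-i) (NormalPath-++⁻ˡ P₁ nonempty path)
    where
    right-of-i : ∀ {v} → v ∈ P₁ → InG G (suc i) _ v
    right-of-i v∈ with All.lookup (++⁻ˡ P₁ inP) v∈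
    ... | i≤v , rest = ≤∧≢⇒< i≤v (λ i≡v → proj₂ (proj₂ (Unique-++⁻ P₁ unique)) (v∈ , here (sym i≡v))) , rest

  module _ (umbrella-free : UmbrellaFree G) where

    InG-left-of : ∀ {a b j x′ r} → InG G b j (suc x′) → InG G a x′ r → InG G a j r
    InG-left-of (_ , x≤j , x≁j′) (a≤r , r≤x′ , r≁x) =
      a≤r , ≤-trans r≤x′ (≤-trans (n≤1+n _) x≤j) ,
      λ rj′ → [ r≁x , x≁j′ ] (umbrella-free _ _ _ (s≤s r≤x′) (s≤s x≤j) rj′)

    right-or-adjacent-step : ∀ {h b z rest} → E G h b → (∀ w → w ∈ rest → E G h w → w ≤ b) →
                             z ∈ rest → b ≢ z → z < h ⊎ E G h z → z < b ⊎ E G b z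
    right-or-adjacent-step _ rightmost z∈ b≢z (inj₂ hz) =
      inj₁ (≤∧≢⇒< (rightmost _ z∈ hz) (λ z≡b → b≢z (sym z≡b)))
    right-or-adjacent-step {b = b} {z} hb rightmost z∈ b≢z (inj₁ z<h) with <-cmp b z
    ... | tri< b<z _ _ =
      inj₂ ([ id , (λ zh → contradiction (rightmost _ z∈ (E-sym zh)) (<⇒≱ b<z)) ]
              (umbrella-free _ _ _ b<z z<h (E-sym hb)))
    ... | tri≈ _ b≡z _ = contradiction b≡z b≢z
    ... | tri> _ _ z<b = inj₁ z<b

    forward-edges-from : ∀ h pre {z suf} → Walk G (h ∷ pre ++ z ∷ suf) → NormalTail G (h ∷ pre ++ z ∷ suf) →
                         All (_≢ z) pre → z < h ⊎ E G h z → All (λ v → v < z → E G v z) pre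
    forward-edges-from h []        _           _                  _              _    = []
    forward-edges-from h (b ∷ pre) (hb , walk) (rightmost , tail) (b≢z ∷ pre≢z) h-ok =
      (λ b<z → [ (λ z<b → contradiction z<b (<⇒≯ b<z)) , id ] b-ok) ∷
      forward-edges-from b pre walk tail pre≢z b-ok
      where
      b-ok = right-or-adjacent-step hb rightmost (there (∈-++⁺ʳ pre (here refl))) b≢z h-ok

    forward-edges : ∀ {S} pre {z suf} → NormalPath G S (pre ++ z ∷ suf) → All (λ v → v < z → E G v z) pre
    forward-edges []        _ = []
    forward-edges (h ∷ pre) ((_ , _ , h∉ ∷ unique , walk) , rightmost , tail) =
      (λ h<z → contradiction z≤h (<⇒≱ h<z)) ∷
      forward-edges-from h pre walk tail pre≢z (inj₁ (≤∧≢⇒< z≤h (λ z≡h → h≢z (sym z≡h))))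
      where
      z∈ = ∈-++⁺ʳ pre (here refl)
      z≤h = All.lookup rightmost z∈
      h≢z = All.lookup h∉ z∈
      pre≢z = All.tabulate λ v∈ v≡z → proj₂ (proj₂ (Unique-++⁻ pre unique)) (v∈ , here v≡z)

    forward-edge : ∀ {S u z} xs {ys} → NormalPath G S (xs ++ ys) → u ∈ xs → z ∈ ys → u < z → E G u z
    forward-edge {S} xs path u∈ z∈ u<z with ∈-∃++ z∈
    ... | ys₁ , ys₂ , refl =
      All.lookup (forward-edges (xs ++ ys₁) (subst (NormalPath G S) (sym (++-assoc xs ys₁ _)) path))
                 (∈-++⁺ˡ u∈) u<z

    NormalPath-edge-redirect : ∀ {S} Q {x b r} → NormalPath G S (Q ∷ʳ x) → b ∈ Q → r < x →
                               ¬ E G r x → E G b r → E G b x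
    NormalPath-edge-redirect Q {x} {b} path b∈ r<x r≁x br with <-cmp b x
    ... | tri< b<x _ _ = forward-edge Q path b∈ (here refl) b<x
    ... | tri≈ _ refl _ = contradiction (E-sym br) r≁x
    ... | tri> _ _ x<b = [ (λ rx → contradiction rx r≁x) , E-sym ] (umbrella-free _ _ _ r<x x<b (E-sym br))

    splice : ∀ {i j x′} Q R → NormalPath G (InG G (suc i) j) (Q ∷ʳ suc x′) → NormalPath G (InG G (suc i) x′) R →
             InG G i j i → E G (suc x′) i → NormalPath G (InG G i j) (Q ∷ʳ suc x′ ++ i ∷ R)
    splice Q [] _ ((nonempty , _) , _) _ _ = contradiction refl nonempty
    splice {i} {j} {x′} Q R@(r₁ ∷ _)
           pathQ@((_ , inQ , uniqueQ , walkQ) , rightmostQ , tailQ)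
           ((_ , inR , uniqueR , walkR) , rightmostR , tailR) i∈ xi =
      (++-∷-nonempty (Q ∷ʳ x) , inT , Unique.++⁺ uniqueQ (i∉R ∷ uniqueR) disjoint , walkT) ,
      FirstRightmost-∷ʳ-++⁺ Q rightmostQ left-of-x ,
      NormalTail-∷ʳ-++⁺ Q tailQ tail-from-x left-of-x cross
      where
      x = suc x′
      i<Q : ∀ {v} → v ∈ Q ∷ʳ x → i < v
      i<Q v∈ = proj₁ (All.lookup inQ v∈)
      i<R : ∀ {r} → r ∈ R → i < r
      i<R r∈ = proj₁ (All.lookup inR r∈)
      R<x : ∀ {r} → r ∈ R → r < x
      R<x r∈ = s≤s (proj₁ (proj₂ (All.lookup inR r∈)))
      R≁x : ∀ {r} → r ∈ R → ¬ E G r x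
      R≁x r∈ = proj₂ (proj₂ (All.lookup inR r∈))
      inT : All (InG G i j) (Q ∷ʳ x ++ i ∷ R)
      inT = ++⁺ (All.map (InG-lower (n≤1+n i)) inQ)
                (i∈ ∷ All.map (λ r∈G → InG-lower (n≤1+n i) (InG-left-of x∈G r∈G)) inR)
        where
        x∈G = All.lookup inQ (∈-++⁺ʳ Q (here refl))
      i∉R : All (i ≢_) R
      i∉R = All.tabulate λ r∈ i≡r → <-irrefl i≡r (i<R r∈)
      disjoint : Disjoint (Q ∷ʳ x) (i ∷ R)
      disjoint (v∈ , here refl) = <-irrefl refl (i<Q v∈)
      disjoint (v∈ , there v∈R) with ∈-++⁻ Q v∈
      ... | inj₁ v∈Q         = R≁x v∈R (forward-edge Q pathQ v∈Q (here refl) (R<x v∈R))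
      ... | inj₂ (here refl) = <-irrefl refl (R<x v∈R)
      walkT : Walk G (Q ∷ʳ x ++ i ∷ R)
      walkT = Walk-∷ʳ-++⁺ Q walkQ (xi , ir₁ , walkR)
        where
        ir₁ = [ id , (λ r₁x → contradiction r₁x (R≁x (here refl))) ]
                (umbrella-free _ _ _ (i<R (here refl)) (R<x (here refl)) (E-sym xi))
      left-of-x : All (_≤ x) (i ∷ R)
      left-of-x = <⇒≤ (i<Q (∈-++⁺ʳ Q (here refl))) ∷ All.tabulate (λ r∈ → <⇒≤ (R<x r∈))
      tail-from-x : NormalTail G (x ∷ i ∷ R)
      tail-from-x = x-rightmost , (λ _ w∈ _ → FirstRightmost-head rightmostR w∈) , tailR
        where
        x-rightmost : ∀ w → w ∈ i ∷ R → E G x w → w ≤ i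
        x-rightmost _ (here refl) _  = ≤-refl
        x-rightmost _ (there w∈R) xw = contradiction (E-sym xw) (R≁x w∈R)
      cross : ∀ {b w} → b ∈ Q → w ∈ i ∷ R → E G b w → E G b x ⊎ All (w ≤_) Q
      cross _  (here refl) _  = inj₂ (All.tabulate λ v∈ → <⇒≤ (i<Q (∈-++⁺ˡ v∈)))
      cross b∈ (there r∈) br = inj₁ (NormalPath-edge-redirect Q pathQ b∈ (R<x r∈) (R≁x r∈) br)

    suffix-normal : ∀ {i j x′} P₁′ P₂ → P₂ ≢ [] → NormalPath G (InG G i j) (P₁′ ∷ʳ suc x′ ++ i ∷ P₂) →
                    NormalPath G (InG G (suc i) x′) P₂
    suffix-normal P₁′ [] nonempty _ = contradiction refl nonempty
    suffix-normal {i} {x′ = x′} P₁′ P₂@(w ∷ P₂′) _ path@((_ , inP , uniqueP , walkP) , _ , tailP) =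
      ((λ ()) , All.tabulate in-window , AllPairs.tail uniqueFromI , Walk-∷⁻ P₂ (Walk-++⁻ʳ P₁ walkP)) ,
      All.tabulate (λ v∈ → i-rightmost _ (there v∈) (i-to (there v∈))) ,
      NormalTail-∷⁻ P₂ tailFromI
      where
      x = suc x′
      P₁ = P₁′ ∷ʳ x
      x∈P₁ = ∈-++⁺ʳ P₁′ (here refl)
      uniqueFromI = proj₁ (proj₂ (Unique-++⁻ P₁ uniqueP))
      tailFromI = NormalTail-++⁻ʳ P₁ tailP
      i-rightmost = proj₁ tailFromI
      x-rightmost = proj₁ (proj₂ (NormalPath-∷ʳ-++⁻ P₁′ path))
      i<P₂ : ∀ {z} → z ∈ P₂ → i < z
      i<P₂ z∈ = ≤∧≢⇒< (proj₁ (All.lookup inP (∈-++⁺ʳ P₁ (there z∈)))) (All.lookup (AllPairs.head uniqueFromI) z∈)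
      i-to : ∀ {z} → z ∈ P₂ → E G i z
      i-to z∈ = forward-edge (P₁ ∷ʳ i) (subst (NormalPath G _) (sym (∷ʳ-++ P₁ i P₂)) path)
                             (∈-++⁺ʳ P₁ (here refl)) z∈ (i<P₂ z∈)
      in-window : ∀ {z} → z ∈ P₂ → InG G (suc i) x′ z
      in-window {z} z∈ = i<P₂ z∈ , ≤-pred z<x , z≁x
        where
        z≁x : ¬ E G z x
        z≁x zx = <⇒≱ (i<P₂ z∈) (x-rightmost z (there z∈) (E-sym zx))
        z<x : z < x
        z<x with <-cmp z x
        ... | tri< z<x _ _ = z<x
        ... | tri≈ _ refl _ = contradiction (x∈P₁ , there z∈) (proj₂ (proj₂ (Unique-++⁻ P₁ uniqueP)))
        ... | tri> _ _ x<z = contradiction (E-sym (forward-edge P₁ path x∈P₁ (there z∈) x<z)) z≁x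

    longest-split : ∀ {i j x′ y} P₁′ P₂ → y ≢ i →
                    LongestNormalEndingAt G (InG G i j) y (P₁′ ∷ʳ suc x′ ++ i ∷ P₂) →
                    LongestNormalEndingAt G (InG G (suc i) j) (suc x′) (P₁′ ∷ʳ suc x′)
                      × LongestNormalEndingAt G (InG G (suc i) x′) y P₂
    longest-split P₁′ [] y≢i (_ , last≡y , _) =
      contradiction (sym (just-injective (trans (sym (last-++ (P₁′ ∷ʳ _))) last≡y))) y≢i
    longest-split {i} {j} {x′} {y} P₁′ P₂@(_ ∷ _) _ (path@((_ , inP , _) , _) , last≡y , longest) =
      (pathP₁ , last-++ P₁′ , longestP₁) , (pathP₂ , lastP₂ , longestP₂)
      where
      P₁ = P₁′ ∷ʳ suc x′
      lastP₂ : last P₂ ≡ just y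
      lastP₂ = trans (sym (last-++ P₁)) last≡y
      pathP₁ = prefix-normal P₁ P₂ (++-∷-nonempty P₁′) path
      pathP₂ = suffix-normal P₁′ P₂ (λ ()) path
      i∈ = All.lookup inP (∈-++⁺ʳ P₁ (here refl))
      xi = proj₁ (proj₁ (NormalPath-∷ʳ-++⁻ P₁′ path))
      longestP₁ : ∀ Q → NormalPath G (InG G (suc i) j) Q → last Q ≡ just (suc x′) → length Q ≤ length P₁
      longestP₁ Q pathQ lastQ with initLast Q
      ... | [] = contradiction lastQ λ ()
      ... | Q′ ∷ʳ′ q with trans (sym (last-++ Q′)) lastQ
      ...   | refl = length-++-cancelʳ-≤ (Q′ ∷ʳ q) P₁ (i ∷ P₂)
                       (longest _ (splice Q′ P₂ pathQ pathP₂ i∈ xi) (trans (last-++ (Q′ ∷ʳ q)) lastP₂))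
      longestP₂ : ∀ R → NormalPath G (InG G (suc i) x′) R → last R ≡ just y → length R ≤ length P₂
      longestP₂ [] ((nonempty , _) , _) _ = contradiction refl nonempty
      longestP₂ R@(_ ∷ _) pathR lastR =
        ≤-pred (length-++-cancelˡ-≤ P₁ (i ∷ R) (i ∷ P₂)
                 (longest _ (splice P₁′ R pathP₁ pathR i∈ xi) (trans (last-++ P₁) lastR)))

lemma12 : (G : Graph) → Cocomparability G → UmbrellaFree G → LDFS G →
          (i j : ℕ) → 1 ≤ i → i ≤ Graph.n G → 1 ≤ j → j ≤ Graph.n G →
          (y : ℕ) → ¬ y ≡ i → (P : List ℕ) →
          LongestNormalEndingAt G (InG G i j) y P →
          (P₁ P₂ : List ℕ) → P ≡ P₁ ++ (i ∷ P₂) →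
          (x : ℕ) → last P₁ ≡ just x →
          LongestNormalEndingAt G (InG G (suc i) j) x P₁
            × LongestNormalEndingAt G (InG G (suc i) (x ∸ 1)) y P₂
lemma12 G _ umbrella-free _ i j 1≤i _ _ _ y y≢i _ longest@(((_ , inP , _) , _) , _) P₁ P₂ refl x last≡x
  with initLast P₁
... | [] = contradiction last≡x λ ()
... | P₁′ ∷ʳ′ zero =
  contradiction (proj₁ (All.lookup inP (∈-++⁺ˡ (∈-++⁺ʳ P₁′ (here refl))))) (<⇒≱ 1≤i)
... | P₁′ ∷ʳ′ suc x′ with trans (sym (last-++ P₁′)) last≡x
...   | refl = longest-split G umbrella-free P₁′ P₂ y≢i longest
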